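{- Let $n_1\le n_2$ be positive integers. Every arrangement of the numbers $1,\dots,n_1n_2$ in an $n_1\times n_2$ matrix has spread at least $\frac{(n_1+1)n_2}{2}-1$ if $n_1$ is odd, and at least $\frac{n_1(n_2+1)}{2}-1$ if $n_1$ is even.
   Context: An arrangement of $1,\dots,n_1n_2$ in an $n_1\times n_2$ matrix is a bijection between $\{1,\dots,n_1n_2\}$ and the cells $\{(i_1,i_2):1\le i_1\le n_1,1\le i_2\le n_2\}$. A line is a row or a column. The spread of an arrangement is the maximum, over all lines, of the difference between the largest and smallest number in that line. (Equivalently, the minimum spread equals the bandwidth of the Cartesian product of cliques $K_{n_1}\times K_{n_2}$.) -}

module Defs where

open import Data.Nat using (ℕ; suc; _+_; _*_; _∸_; _⊔_; _⊓_)
open import Data.Fin using (Fin; toℕ)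
open import Data.Product using (_×_; _,_)
open import Data.List using (List; map; foldr)
open import Data.List.Base using (allFin)
open import Function.Bundles using (Bijection)
open import Relation.Binary.PropositionalEquality using (setoid)

-- An arrangement of 1,…,n₁n₂ in an n₁×n₂ matrix: a bijection from the
-- cells (Fin n₁ × Fin n₂) to Fin (n₁ * n₂); the entry of a cell c is
-- toℕ (f c) + 1 ∈ {1,…,n₁n₂}.
Arrangement : ℕ → ℕ → Set
Arrangement n₁ n₂ = Bijection (setoid (Fin n₁ × Fin n₂)) (setoid (Fin (n₁ * n₂)))

entry : ∀ {n₁ n₂} → Arrangement n₁ n₂ → Fin n₁ → Fin n₂ → ℕ
entry A i j = suc (toℕ (Bijection.to A (i , j)))

-- maximum / minimum of a list of naturals (entries are ≥ 1, and lines are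
-- nonempty whenever n₁, n₂ ≥ 1; the default values are never attained then)
maxL : List ℕ → ℕ
maxL = foldr _⊔_ 0

minL : ℕ → List ℕ → ℕ
minL d = foldr _⊓_ d

lineSpread : List ℕ → ℕ
lineSpread xs = maxL xs ∸ minL (maxL xs) xs

rowValues : ∀ {n₁ n₂} → Arrangement n₁ n₂ → Fin n₁ → List ℕ
rowValues {n₂ = n₂} A i = map (λ j → entry A i j) (allFin n₂)

colValues : ∀ {n₁ n₂} → Arrangement n₁ n₂ → Fin n₂ → List ℕ
colValues {n₁ = n₁} A j = map (λ i → entry A i j) (allFin n₁)

spread : ∀ {n₁ n₂} → Arrangement n₁ n₂ → ℕ
spread {n₁} {n₂} A =
  maxL (map (λ i → lineSpread (rowValues A i)) (allFin n₁))
  ⊔ maxL (map (λ j → lineSpread (colValues A j)) (allFin n₂))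

{-# OPTIONS --safe #-}
-- Write the entries as 0, …, n₁n₂ − 1, let s be the spread and fix a threshold k. A cell with
-- entry below k lies in a row and a column that both meet {0, …, k − 1}; a cell with entry above
-- k + s lies, since every line has spread at most s, in a row and a column all of whose entries
-- exceed k; every other cell holds one of the s + 1 values k, …, k + s. Hence
--   n₁n₂ ≤ a b + ā b̄ + (s + 1),
-- where a, b count the rows and columns meeting {0, …, k − 1} and ā, b̄ those avoiding {0, …, k}.
-- For n₁ = 2m + 1 choose k where the number of rows meeting first exceeds m; for n₁ = 2m choose
-- k where the numbers of rows and of columns meeting first both reach m. Then a b + ā b̄ is at
-- most m n₂ in the odd case and at most m n₂ − m in the even case (using n₁ ≤ n₂), and the
-- bound follows.
module Submission where

open import Defs
open import Data.Empty using (⊥)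
open import Data.Fin using (Fin; zero; suc; toℕ; fromℕ<; _↑ˡ_; _↑ʳ_; combine)
open import Data.Fin.Permutation using (Permutation; _⟨$⟩ʳ_)
open import Data.Fin.Properties using (any?; toℕ<n; remQuot-combine; *↔×)
open import Data.List using ([]; _∷_)
open import Data.List.Membership.Propositional using (_∈_)
open import Data.List.Membership.Propositional.Properties using (∈-map⁺; ∈-allFin)
open import Data.List.Relation.Unary.Any using (here; there)
open import Data.Nat
  using (ℕ; zero; suc; _+_; _*_; _∸_; _≤_; _<_; _%_; _/_; z≤n; s≤s; s≤s⁻¹; z<s; _≤?_; _<?_)
open import Data.Nat.DivMod using (m≡m%n+[m/n]*n)
open import Data.Nat.Properties
open import Data.Nat.Tactic.RingSolver using (solve)
open import Data.Product as Product using (_×_; _,_; ∃-syntax)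
open import Data.Sum using (_⊎_; inj₁; inj₂)
open import Function using (_∘_)
open import Function.Bundles using (Bijection)
open import Function.Construct.Composition using (_↔-∘_)
open import Function.Properties.Bijection using (⤖⇒↔)
open import Level using (Level)
open import Relation.Binary.PropositionalEquality using (_≡_; refl; sym; trans; cong; cong₂; module ≡-Reasoning)
open import Relation.Nullary using (Dec; yes; no; ¬_; contradiction)
open import Relation.Nullary.Decidable using (_×-dec_; ¬?)
open import Relation.Unary using (Pred; Decidable; _⊆_)
open import Relation.Unary.Properties using (∁?)

open import Algebra.Properties.CommutativeSemigroup +-commutativeSemigroup using (xy∙z≈xz∙y)
open import Algebra.Properties.Semiring.Sum +-*-semiring
  using (sum; sum-syntax; ∑-distrib-+; sum-cong-≗; *-distribˡ-sum; *-distribʳ-sum; sum-permute)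

sum-mono-≤ : ∀ {n} {f g : Fin n → ℕ} → (∀ i → f i ≤ g i) → sum f ≤ sum g
sum-mono-≤ {zero}  f≤g = z≤n
sum-mono-≤ {suc n} f≤g = +-mono-≤ (f≤g zero) (sum-mono-≤ (f≤g ∘ suc))

sum-const : ∀ n c → ∑[ i < n ] c ≡ n * c
sum-const zero    c = refl
sum-const (suc n) c = cong (c +_) (sum-const n c)

sum-↑ˡ-↑ʳ : ∀ m n (f : Fin (m + n) → ℕ) →
            sum f ≡ ∑[ i < m ] f (i ↑ˡ n) + ∑[ j < n ] f (m ↑ʳ j)
sum-↑ˡ-↑ʳ zero    n f = refl
sum-↑ˡ-↑ʳ (suc m) n f =
  trans (cong (f zero +_) (sum-↑ˡ-↑ʳ m n (f ∘ suc))) (sym (+-assoc (f zero) _ _))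

sum-combine : ∀ m n (f : Fin (m * n) → ℕ) → sum f ≡ ∑[ i < m ] ∑[ j < n ] f (combine i j)
sum-combine zero    n f = refl
sum-combine (suc m) n f =
  trans (sum-↑ˡ-↑ʳ n (m * n) f) (cong (sum (f ∘ (_↑ˡ m * n)) +_) (sum-combine m n (f ∘ (n ↑ʳ_))))

∑∑-distrib-+ : ∀ {m n} (f g : Fin m → Fin n → ℕ) →
               ∑[ i < m ] ∑[ j < n ] (f i j + g i j)
               ≡ ∑[ i < m ] ∑[ j < n ] f i j + ∑[ i < m ] ∑[ j < n ] g i j
∑∑-distrib-+ f g =
  trans (sum-cong-≗ (λ i → ∑-distrib-+ (f i) (g i))) (∑-distrib-+ (λ i → sum (f i)) (λ i → sum (g i)))

∑∑-* : ∀ {m n} (f : Fin m → ℕ) (g : Fin n → ℕ) → ∑[ i < m ] ∑[ j < n ] (f i * g j) ≡ sum f * sum g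
∑∑-* f g = trans (sum-cong-≗ (λ i → sym (*-distribˡ-sum (f i) g))) (sym (*-distribʳ-sum (sum g) f))

private
  variable
    ℓ₁ ℓ₂ ℓ₃ : Level
    P : Set ℓ₁
    Q : Set ℓ₂
    R : Set ℓ₃

𝟙 : Dec P → ℕ
𝟙 (yes _) = 1
𝟙 (no _)  = 0

𝟙-yes : P → (P? : Dec P) → 𝟙 P? ≡ 1
𝟙-yes p (yes _) = refl
𝟙-yes p (no ¬p) = contradiction p ¬p

𝟙-no : ¬ P → (P? : Dec P) → 𝟙 P? ≡ 0
𝟙-no ¬p (yes p) = contradiction p ¬p
𝟙-no ¬p (no _)  = refl

𝟙+𝟙¬ : (P? : Dec P) → 𝟙 P? + 𝟙 (¬? P?) ≡ 1
𝟙+𝟙¬ (yes _) = refl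
𝟙+𝟙¬ (no _)  = refl

𝟙-mono : (P → Q) → (P? : Dec P) (Q? : Dec Q) → 𝟙 P? ≤ 𝟙 Q?
𝟙-mono P⇒Q (yes p) Q? = ≤-reflexive (sym (𝟙-yes (P⇒Q p) Q?))
𝟙-mono P⇒Q (no _)  Q? = z≤n

𝟙-cong : (P → Q) → (Q → P) → (P? : Dec P) (Q? : Dec Q) → 𝟙 P? ≡ 𝟙 Q?
𝟙-cong P⇒Q Q⇒P P? Q? = ≤-antisym (𝟙-mono P⇒Q P? Q?) (𝟙-mono Q⇒P Q? P?)

𝟙-×-dec : (P? : Dec P) (Q? : Dec Q) → 𝟙 (P? ×-dec Q?) ≡ 𝟙 P? * 𝟙 Q?
𝟙-×-dec (yes _) (yes _) = refl
𝟙-×-dec (yes _) (no _)  = refl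
𝟙-×-dec (no _)  (yes _) = refl
𝟙-×-dec (no _)  (no _)  = refl

1≤𝟙+𝟙+𝟙 : (P? : Dec P) (Q? : Dec Q) (R? : Dec R) → P ⊎ Q ⊎ R → 1 ≤ 𝟙 P? + 𝟙 Q? + 𝟙 R?
1≤𝟙+𝟙+𝟙 P? Q? R? (inj₁ p) rewrite 𝟙-yes p P? = s≤s z≤n
1≤𝟙+𝟙+𝟙 P? Q? R? (inj₂ (inj₁ q)) rewrite 𝟙-yes q Q? = ≤-trans (m≤n+m 1 (𝟙 P?)) (m≤m+n _ (𝟙 R?))
1≤𝟙+𝟙+𝟙 P? Q? R? (inj₂ (inj₂ r)) rewrite 𝟙-yes r R? = m≤n+m 1 _

count : ∀ {n ℓ} {P : Pred (Fin n) ℓ} → Decidable P → ℕ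
count {n} P? = ∑[ i < n ] 𝟙 (P? i)

module _ {n ℓ} {P : Pred (Fin n) ℓ} (P? : Decidable P) where

  count+count∁ : count P? + count (∁? P?) ≡ n
  count+count∁ = begin
    count P? + count (∁? P?)            ≡⟨ ∑-distrib-+ (𝟙 ∘ P?) (𝟙 ∘ ∁? P?) ⟨
    ∑[ i < n ] (𝟙 (P? i) + 𝟙 (∁? P? i))  ≡⟨ sum-cong-≗ (𝟙+𝟙¬ ∘ P?) ⟩
    ∑[ i < n ] 1                        ≡⟨ sum-const n 1 ⟩
    n * 1                               ≡⟨ *-identityʳ n ⟩
    n                                   ∎
    where open ≡-Reasoning

  count-mono : ∀ {Q : Pred (Fin n) ℓ} (Q? : Decidable Q) → P ⊆ Q → count P? ≤ count Q?
  count-mono Q? P⊆Q = sum-mono-≤ (λ i → 𝟙-mono P⊆Q (P? i) (Q? i))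

  count-all : (∀ i → P i) → count P? ≡ n
  count-all all = trans (sum-cong-≗ (λ i → 𝟙-yes (all i) (P? i))) (trans (sum-const n 1) (*-identityʳ n))

  count-none : (∀ i → ¬ P i) → count P? ≡ 0
  count-none none = trans (sum-cong-≗ (λ i → 𝟙-no (none i) (P? i))) (trans (sum-const n 0) (*-zeroʳ n))

∑∑-𝟙-×-dec : ∀ {m n ℓ} {P : Pred (Fin m) ℓ} {Q : Pred (Fin n) ℓ} (P? : Decidable P) (Q? : Decidable Q) →
             ∑[ i < m ] ∑[ j < n ] 𝟙 (P? i ×-dec Q? j) ≡ count P? * count Q?
∑∑-𝟙-×-dec P? Q? =
  trans (sum-cong-≗ (λ i → sum-cong-≗ (λ j → 𝟙-×-dec (P? i) (Q? j)))) (∑∑-* (𝟙 ∘ P?) (𝟙 ∘ Q?))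

InInterval : ℕ → ℕ → ℕ → Set
InInterval k w v = k ≤ v × v < k + w

inInterval? : ∀ k w v → Dec (InInterval k w v)
inInterval? k w v = k ≤? v ×-dec v <? k + w

inInterval-suc : ∀ k w v → 𝟙 (inInterval? (suc k) w (suc v)) ≡ 𝟙 (inInterval? k w v)
inInterval-suc k w v =
  𝟙-cong (Product.map s≤s⁻¹ s≤s⁻¹) (Product.map s≤s s≤s) (inInterval? (suc k) w (suc v)) (inInterval? k w v)

inInterval-0-suc : ∀ w v → 𝟙 (inInterval? 0 (suc w) (suc v)) ≡ 𝟙 (inInterval? 0 w v)
inInterval-0-suc w v =
  𝟙-cong (Product.map (λ _ → z≤n) s≤s⁻¹) (Product.map (λ _ → z≤n) s≤s)
         (inInterval? 0 (suc w) (suc v)) (inInterval? 0 w v)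

count-inInterval≤ : ∀ n k w → ∑[ l < n ] 𝟙 (inInterval? k w (toℕ l)) ≤ w
count-inInterval≤ zero    k       w       = z≤n
count-inInterval≤ (suc n) (suc k) w       = begin
  𝟙 (inInterval? (suc k) w 0) + ∑[ l < n ] 𝟙 (inInterval? (suc k) w (suc (toℕ l)))
    ≡⟨ cong₂ _+_ (𝟙-no (λ ()) (inInterval? (suc k) w 0)) (sum-cong-≗ {n} (inInterval-suc k w ∘ toℕ)) ⟩
  ∑[ l < n ] 𝟙 (inInterval? k w (toℕ l))
    ≤⟨ count-inInterval≤ n k w ⟩
  w ∎
  where open ≤-Reasoning
count-inInterval≤ (suc n) zero    zero    =
  ≤-reflexive (count-none (λ (l : Fin (suc n)) → inInterval? 0 0 (toℕ l)) (λ _ → λ ()))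
count-inInterval≤ (suc n) zero    (suc w) = begin
  𝟙 (inInterval? 0 (suc w) 0) + ∑[ l < n ] 𝟙 (inInterval? 0 (suc w) (suc (toℕ l)))
    ≡⟨ cong₂ _+_ (𝟙-yes (z≤n , s≤s z≤n) (inInterval? 0 (suc w) 0))
                 (sum-cong-≗ {n} (inInterval-0-suc w ∘ toℕ)) ⟩
  1 + ∑[ l < n ] 𝟙 (inInterval? 0 w (toℕ l))
    ≤⟨ +-monoʳ-≤ 1 (count-inInterval≤ n 0 w) ⟩
  suc w ∎
  where open ≤-Reasoning

discrete-ivt : ∀ {a} {P : ℕ → Set a} → Decidable P → ¬ P 0 → ∀ {n} → P n → ∃[ k ] ¬ P k × P (suc k)
discrete-ivt P? ¬P0 {zero}  Pn = contradiction Pn ¬P0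
discrete-ivt P? ¬P0 {suc n} Pn with P? n
... | yes Pn′ = discrete-ivt P? ¬P0 Pn′
... | no ¬Pn′ = n , ¬Pn′ , Pn

complement-≤ : ∀ {x y m n} → x + y ≡ m + n → m ≤ x → y ≤ n
complement-≤ {x} {y} {m} {n} x+y≡m+n m≤x =
  +-cancelˡ-≤ m y n (≤-trans (+-monoˡ-≤ y m≤x) (≤-reflexive x+y≡m+n))

*+*≤* : ∀ {a ā b b̄ m n} → a ≤ m → ā ≤ m → b + b̄ ≤ n → a * b + ā * b̄ ≤ m * n
*+*≤* {a} {ā} {b} {b̄} {m} {n} a≤m ā≤m b+b̄≤n = begin
  a * b + ā * b̄  ≤⟨ +-mono-≤ (*-monoˡ-≤ b a≤m) (*-monoˡ-≤ b̄ ā≤m) ⟩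
  m * b + m * b̄  ≡⟨ *-distribˡ-+ m b b̄ ⟨
  m * (b + b̄)    ≤⟨ *-monoʳ-≤ m b+b̄≤n ⟩
  m * n          ∎
  where open ≤-Reasoning

ab+āb̄+m≤mn-a<m : ∀ {a ā b b′ b̄ m n} → a < m → ā ≤ m → b ≤ b′ → m ≤ b′ → b′ + b̄ ≤ n →
                 a * b + ā * b̄ + m ≤ m * n
ab+āb̄+m≤mn-a<m {a} {ā} {b} {b′} {b̄} {m} {n} a<m ā≤m b≤b′ m≤b′ b′+b̄≤n = begin
  a * b + ā * b̄ + m     ≤⟨ +-mono-≤ (+-monoˡ-≤ (ā * b̄) (*-monoʳ-≤ a b≤b′)) m≤b′ ⟩
  a * b′ + ā * b̄ + b′   ≡⟨ solve (a ∷ ā ∷ b′ ∷ b̄ ∷ []) ⟩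
  suc a * b′ + ā * b̄    ≤⟨ *+*≤* a<m ā≤m b′+b̄≤n ⟩
  m * n                 ∎
  where open ≤-Reasoning

[m+d]b+āb̄+m≤m[m+c] : ∀ {m c d ā b b̄} → d + ā ≡ m → b < m → b ≤ c → b̄ ≤ c →
                     (m + d) * b + ā * b̄ + m ≤ m * (m + c)
[m+d]b+āb̄+m≤m[m+c] {m} {c} {d} {ā} {b} {b̄} d+ā≡m b<m b≤c b̄≤c = begin
  (m + d) * b + ā * b̄ + m      ≡⟨ solve (m ∷ d ∷ b ∷ ā ∷ b̄ ∷ []) ⟩
  m * suc b + (b * d + b̄ * ā)  ≤⟨ +-mono-≤ (*-monoʳ-≤ m b<m) (*+*≤* b≤c b̄≤c (≤-reflexive d+ā≡m)) ⟩
  m * m + c * m                ≡⟨ solve (m ∷ c ∷ []) ⟩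
  m * (m + c)                  ∎
  where open ≤-Reasoning

ab+āb̄+m≤mn-b<m : ∀ {a ā b b̄ m n} → b < m → a + ā ≤ m * 2 → ā ≤ m → b̄ + m ≤ n → m * 2 ≤ n →
                 a * b + ā * b̄ + m ≤ m * n
ab+āb̄+m≤mn-b<m {a} {ā} {b} {b̄} {m} {n} b<m a+ā≤2m ā≤m b̄+m≤n 2m≤n = begin
  a * b + ā * b̄ + m        ≤⟨ +-monoˡ-≤ m (+-monoˡ-≤ (ā * b̄) (*-monoˡ-≤ b a≤m+d)) ⟩
  (m + d) * b + ā * b̄ + m  ≤⟨ [m+d]b+āb̄+m≤m[m+c] d+ā≡m b<m (≤-trans (<⇒≤ b<m) m≤c) b̄≤c ⟩
  m * (m + c)              ≡⟨ cong (m *_) m+c≡n ⟩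
  m * n                    ∎
  where
  open ≤-Reasoning
  d = m ∸ ā
  c = n ∸ m
  d+ā≡m : d + ā ≡ m
  d+ā≡m = m∸n+n≡m ā≤m
  m+m≡m*2 : m + m ≡ m * 2
  m+m≡m*2 = solve (m ∷ [])
  m+m≤n : m + m ≤ n
  m+m≤n = ≤-trans (≤-reflexive m+m≡m*2) 2m≤n
  m+c≡n : m + c ≡ n
  m+c≡n = m+[n∸m]≡n (≤-trans (m≤m+n m m) m+m≤n)
  m≤c : m ≤ c
  m≤c = +-cancelˡ-≤ m m c (≤-trans m+m≤n (≤-reflexive (sym m+c≡n)))
  b̄≤c : b̄ ≤ c
  b̄≤c = +-cancelˡ-≤ m b̄ c (begin
    m + b̄  ≡⟨ +-comm m b̄ ⟩
    b̄ + m  ≤⟨ b̄+m≤n ⟩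
    n      ≡⟨ m+c≡n ⟨
    m + c  ∎)
  a≤m+d : a ≤ m + d
  a≤m+d = +-cancelʳ-≤ ā a (m + d) (begin
    a + ā        ≤⟨ a+ā≤2m ⟩
    m * 2        ≡⟨ m+m≡m*2 ⟨
    m + m        ≡⟨ cong (m +_) d+ā≡m ⟨
    m + (d + ā)  ≡⟨ +-assoc m d ā ⟨
    m + d + ā    ∎)

ab+āb̄+m≤mn : ∀ {a a′ ā b b′ b̄ m n} → ¬ (m ≤ a × m ≤ b) → a ≤ a′ → b ≤ b′ → m ≤ a′ → m ≤ b′ →
             a′ + ā ≡ m * 2 → b′ + b̄ ≡ n → m * 2 ≤ n → a * b + ā * b̄ + m ≤ m * n
ab+āb̄+m≤mn {a} {a′} {ā} {b} {b′} {b̄} {m} {n} unbalanced a≤a′ b≤b′ m≤a′ m≤b′ a′+ā≡m*2 b′+b̄≡n m*2≤n =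
  by-cases (m ≤? a)
  where
  m*2≡m+m : m * 2 ≡ m + m
  m*2≡m+m = solve (m ∷ [])
  ā≤m : ā ≤ m
  ā≤m = complement-≤ (trans a′+ā≡m*2 m*2≡m+m) m≤a′
  by-cases : Dec (m ≤ a) → a * b + ā * b̄ + m ≤ m * n
  by-cases (yes m≤a) = ab+āb̄+m≤mn-b<m (≰⇒> (λ m≤b → unbalanced (m≤a , m≤b)))
                         (≤-trans (+-monoˡ-≤ ā a≤a′) (≤-reflexive a′+ā≡m*2)) ā≤m
                         (≤-trans (+-monoʳ-≤ b̄ m≤b′) (≤-reflexive (trans (+-comm b̄ b′) b′+b̄≡n))) m*2≤n
  by-cases (no m≰a)  = ab+āb̄+m≤mn-a<m (≰⇒> m≰a) ā≤m b≤b′ m≤b′ (≤-reflexive b′+b̄≡n)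

Meets : ∀ {n} → (Fin n → ℕ) → ℕ → Set
Meets line k = ∃[ j ] line j < k

meets? : ∀ {n} (line : Fin n → ℕ) k → Dec (Meets line k)
meets? line k = any? (λ j → line j <? k)

module _ {m n} (L : Fin m → Fin n → ℕ) where

  linesMeeting linesAvoiding : ℕ → ℕ
  linesMeeting  k = count (λ a → meets? (L a) k)
  linesAvoiding k = count (∁? (λ a → meets? (L a) k))

  linesMeeting+linesAvoiding : ∀ k → linesMeeting k + linesAvoiding k ≡ m
  linesMeeting+linesAvoiding k = count+count∁ (λ a → meets? (L a) k)

  linesMeeting-mono : ∀ k → linesMeeting k ≤ linesMeeting (suc k)
  linesMeeting-mono k =
    count-mono (λ a → meets? (L a) k) (λ a → meets? (L a) (suc k)) (Product.map₂ m≤n⇒m≤1+n)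

  linesMeeting-zero : linesMeeting 0 ≡ 0
  linesMeeting-zero = count-none (λ a → meets? (L a) 0) (λ { a (_ , ()) })

  linesMeeting-all : Fin n → ∀ {N} → (∀ a b → L a b < N) → linesMeeting N ≡ m
  linesMeeting-all b {N} L<N = count-all (λ a → meets? (L a) N) (λ a → b , L<N a b)

  linesMeeting-threshold : Fin n → ∀ {N} → (∀ a b → L a b < N) → ∀ {c} → c < m →
                           ∃[ k ] linesMeeting k ≤ c × c < linesMeeting (suc k)
  linesMeeting-threshold b {N} L<N {c} c<m with discrete-ivt (λ k → c <? linesMeeting k) c≮meeting₀ c<meetingₙ
    where
    c≮meeting₀ : ¬ c < linesMeeting 0
    c≮meeting₀ c<meeting₀ = n≮0 (≤-trans c<meeting₀ (≤-reflexive linesMeeting-zero))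
    c<meetingₙ : c < linesMeeting N
    c<meetingₙ = ≤-trans c<m (≤-reflexive (sym (linesMeeting-all b L<N)))
  ... | k , c≮meetingₖ , c<meetingₖ₊₁ = k , ≮⇒≥ c≮meetingₖ , c<meetingₖ₊₁

∈⇒≤maxL : ∀ {x xs} → x ∈ xs → x ≤ maxL xs
∈⇒≤maxL {xs = y ∷ ys} (here refl)  = m≤m⊔n y (maxL ys)
∈⇒≤maxL {xs = y ∷ ys} (there x∈ys) = ≤-trans (∈⇒≤maxL x∈ys) (m≤n⊔m y (maxL ys))

∈⇒minL≤ : ∀ {d x xs} → x ∈ xs → minL d xs ≤ x
∈⇒minL≤ {xs = y ∷ ys} (here refl)  = m⊓n≤m y _
∈⇒minL≤ {xs = y ∷ ys} (there x∈ys) = ≤-trans (m⊓n≤n y _) (∈⇒minL≤ x∈ys)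

∈⇒≤+lineSpread : ∀ {x y xs} → x ∈ xs → y ∈ xs → x ≤ y + lineSpread xs
∈⇒≤+lineSpread {x} {y} {xs} x∈xs y∈xs = begin
  x                                  ≤⟨ ∈⇒≤maxL x∈xs ⟩
  maxL xs                            ≤⟨ m≤n+m∸n (maxL xs) (minL (maxL xs) xs) ⟩
  minL (maxL xs) xs + lineSpread xs  ≤⟨ +-monoˡ-≤ (lineSpread xs) (∈⇒minL≤ y∈xs) ⟩
  y + lineSpread xs                  ∎
  where open ≤-Reasoning

module _ {n₁ n₂} (A : Arrangement n₁ n₂) where

  value : Fin n₁ → Fin n₂ → ℕ
  value i j = toℕ (Bijection.to A (i , j))

  column : Fin n₂ → Fin n₁ → ℕ
  column j i = value i j

  ∑∑-value : (g : ℕ → ℕ) → ∑[ i < n₁ ] ∑[ j < n₂ ] g (value i j) ≡ ∑[ l < n₁ * n₂ ] g (toℕ l)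
  ∑∑-value g = begin
    ∑[ i < n₁ ] ∑[ j < n₂ ] g (value i j)
      ≡⟨ sum-cong-≗ (λ i → sum-cong-≗ (λ j →
           cong (g ∘ toℕ ∘ Bijection.to A) (sym (remQuot-combine i j)))) ⟩
    ∑[ i < n₁ ] ∑[ j < n₂ ] g (toℕ (π ⟨$⟩ʳ combine i j))
      ≡⟨ sum-combine n₁ n₂ (λ x → g (toℕ (π ⟨$⟩ʳ x))) ⟨
    ∑[ x < n₁ * n₂ ] g (toℕ (π ⟨$⟩ʳ x))
      ≡⟨ sum-permute (g ∘ toℕ) π ⟨
    ∑[ l < n₁ * n₂ ] g (toℕ l) ∎
    where
    open ≡-Reasoning
    π : Permutation (n₁ * n₂) (n₁ * n₂)
    π = ⤖⇒↔ A ↔-∘ *↔×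

  rowSpread≤spread : ∀ i → lineSpread (rowValues A i) ≤ spread A
  rowSpread≤spread i =
    ≤-trans (∈⇒≤maxL (∈-map⁺ (λ i → lineSpread (rowValues A i)) (∈-allFin i))) (m≤m⊔n _ _)

  colSpread≤spread : ∀ j → lineSpread (colValues A j) ≤ spread A
  colSpread≤spread j =
    ≤-trans (∈⇒≤maxL (∈-map⁺ (λ j → lineSpread (colValues A j)) (∈-allFin j))) (m≤n⊔m _ _)

  entry∈row : ∀ i j → entry A i j ∈ rowValues A i
  entry∈row i j = ∈-map⁺ (entry A i) (∈-allFin j)

  entry∈col : ∀ i j → entry A i j ∈ colValues A j
  entry∈col i j = ∈-map⁺ (λ i → entry A i j) (∈-allFin i)

  value-row : ∀ i j j′ → value i j ≤ value i j′ + spread A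
  value-row i j j′ = s≤s⁻¹ (≤-trans (∈⇒≤+lineSpread (entry∈row i j) (entry∈row i j′))
                                    (+-monoʳ-≤ (entry A i j′) (rowSpread≤spread i)))

  value-col : ∀ j i i′ → value i j ≤ value i′ j + spread A
  value-col j i i′ = s≤s⁻¹ (≤-trans (∈⇒≤+lineSpread (entry∈col i j) (entry∈col i′ j))
                                    (+-monoʳ-≤ (entry A i′ j) (colSpread≤spread j)))

  cell-trichotomy : ∀ k i j →
    (Meets (value i) k × Meets (column j) k) ⊎
    InInterval k (spread A + 1) (value i j) ⊎
    (¬ Meets (value i) (suc k) × ¬ Meets (column j) (suc k))
  cell-trichotomy k i j with value i j <? k | value i j <? k + (spread A + 1)
  ... | yes v<k | _        = inj₁ ((j , v<k) , (i , v<k))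
  ... | no v≮k  | yes v<k+ = inj₂ (inj₁ (≮⇒≥ v≮k , v<k+))
  ... | no _    | no v≮k+  =
    inj₂ (inj₂ ( (λ (j′ , v′<1+k) → far (value-row i j j′) v′<1+k)
               , (λ (i′ , v′<1+k) → far (value-col j i i′) v′<1+k)))
    where
    far : ∀ {v′} → value i j ≤ v′ + spread A → v′ < suc k → ⊥
    far {v′} v≤v′+s (s≤s v′≤k) = v≮k+ (begin-strict
      value i j      ≤⟨ v≤v′+s ⟩
      v′ + spread A  ≤⟨ +-monoˡ-≤ (spread A) v′≤k ⟩
      k + spread A   <⟨ +-monoʳ-< k (m<m+n (spread A) z<s) ⟩
      k + (spread A + 1) ∎)
      where open ≤-Reasoning

  cell-count-bound : ∀ k → n₁ * n₂ ≤ linesMeeting value k * linesMeeting column k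
                                    + linesAvoiding value (suc k) * linesAvoiding column (suc k) + (spread A + 1)
  cell-count-bound k = begin
    n₁ * n₂
      ≡⟨ ∑∑1≡n₁*n₂ ⟨
    ∑[ i < n₁ ] ∑[ j < n₂ ] 1
      ≤⟨ sum-mono-≤ (sum-mono-≤ ∘ cover) ⟩
    ∑[ i < n₁ ] ∑[ j < n₂ ] (𝟙 (near? i j) + 𝟙 (band? i j) + 𝟙 (far? i j))
      ≡⟨ split ⟩
    ∑∑𝟙 near? + ∑∑𝟙 band? + ∑∑𝟙 far?
      ≡⟨ cong₂ (λ x y → x + ∑∑𝟙 band? + y)
               (∑∑-𝟙-×-dec (λ i → meets? (value i) k) (λ j → meets? (column j) k))
               (∑∑-𝟙-×-dec (∁? (λ i → meets? (value i) (suc k))) (∁? (λ j → meets? (column j) (suc k)))) ⟩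
    a * b + ∑∑𝟙 band? + ā * b̄       ≡⟨ xy∙z≈xz∙y (a * b) (∑∑𝟙 band?) (ā * b̄) ⟩
    a * b + ā * b̄ + ∑∑𝟙 band?       ≤⟨ +-monoʳ-≤ (a * b + ā * b̄) band≤ ⟩
    a * b + ā * b̄ + (spread A + 1)  ∎
    where
    open ≤-Reasoning
    a = linesMeeting value k
    b = linesMeeting column k
    ā = linesAvoiding value (suc k)
    b̄ = linesAvoiding column (suc k)
    near? : ∀ i j → Dec (Meets (value i) k × Meets (column j) k)
    near? i j = meets? (value i) k ×-dec meets? (column j) k
    band? : ∀ i j → Dec (InInterval k (spread A + 1) (value i j))
    band? i j = inInterval? k (spread A + 1) (value i j)
    far? : ∀ i j → Dec (¬ Meets (value i) (suc k) × ¬ Meets (column j) (suc k))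
    far? i j = ¬? (meets? (value i) (suc k)) ×-dec ¬? (meets? (column j) (suc k))
    ∑∑𝟙 : ∀ {P : Fin n₁ → Fin n₂ → Set} → (∀ i j → Dec (P i j)) → ℕ
    ∑∑𝟙 P? = ∑[ i < n₁ ] ∑[ j < n₂ ] 𝟙 (P? i j)
    ∑∑1≡n₁*n₂ : ∑[ i < n₁ ] ∑[ j < n₂ ] 1 ≡ n₁ * n₂
    ∑∑1≡n₁*n₂ = trans (sum-cong-≗ {n₁} (λ i → trans (sum-const n₂ 1) (*-identityʳ n₂))) (sum-const n₁ n₂)
    cover : ∀ i j → 1 ≤ 𝟙 (near? i j) + 𝟙 (band? i j) + 𝟙 (far? i j)
    cover i j = 1≤𝟙+𝟙+𝟙 (near? i j) (band? i j) (far? i j) (cell-trichotomy k i j)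
    split : ∑[ i < n₁ ] ∑[ j < n₂ ] (𝟙 (near? i j) + 𝟙 (band? i j) + 𝟙 (far? i j))
            ≡ ∑∑𝟙 near? + ∑∑𝟙 band? + ∑∑𝟙 far?
    split = trans (∑∑-distrib-+ (λ i j → 𝟙 (near? i j) + 𝟙 (band? i j)) (λ i j → 𝟙 (far? i j)))
                  (cong (_+ ∑∑𝟙 far?) (∑∑-distrib-+ (λ i j → 𝟙 (near? i j)) (λ i j → 𝟙 (band? i j))))
    band≤ : ∑∑𝟙 band? ≤ spread A + 1
    band≤ = ≤-trans (≤-reflexive (∑∑-value (λ v → 𝟙 (inInterval? k (spread A + 1) v))))
                    (count-inInterval≤ (n₁ * n₂) k (spread A + 1))

  spread-bound-odd : Fin n₂ → ∀ m → n₁ ≡ 1 + m * 2 → (n₁ + 1) * n₂ ≤ 2 * (spread A + 1)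
  spread-bound-odd j₀ m n₁≡
    with linesMeeting-threshold value j₀ (λ _ _ → toℕ<n _) m<n₁
    where
    m<n₁ : m < n₁
    m<n₁ = ≤-trans (s≤s (m≤m*n m 2)) (≤-reflexive (sym n₁≡))
  ... | k , a≤m , m<a′ = begin
    (n₁ + 1) * n₂         ≡⟨ cong (λ x → (x + 1) * n₂) n₁≡ ⟩
    (1 + m * 2 + 1) * n₂  ≡⟨ solve (m ∷ n₂ ∷ []) ⟩
    2 * ((m + 1) * n₂)    ≤⟨ *-monoʳ-≤ 2 (+-cancelˡ-≤ (m * n₂) ((m + 1) * n₂) S counted) ⟩
    2 * S                 ∎
    where
    open ≤-Reasoning
    S = spread A + 1
    a = linesMeeting value k
    b = linesMeeting column k
    ā = linesAvoiding value (suc k)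
    b̄ = linesAvoiding column (suc k)
    n₁≡suc-m+m : n₁ ≡ suc m + m
    n₁≡suc-m+m = trans n₁≡ (solve (m ∷ []))
    ā≤m : ā ≤ m
    ā≤m = complement-≤ (trans (linesMeeting+linesAvoiding value (suc k)) n₁≡suc-m+m) m<a′
    b+b̄≤n₂ : b + b̄ ≤ n₂
    b+b̄≤n₂ = ≤-trans (+-monoˡ-≤ b̄ (linesMeeting-mono column k))
                     (≤-reflexive (linesMeeting+linesAvoiding column (suc k)))
    counted : m * n₂ + (m + 1) * n₂ ≤ m * n₂ + S
    counted = begin
      m * n₂ + (m + 1) * n₂  ≡⟨ solve (m ∷ n₂ ∷ []) ⟩
      (1 + m * 2) * n₂       ≡⟨ cong (_* n₂) n₁≡ ⟨
      n₁ * n₂                ≤⟨ cell-count-bound k ⟩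
      a * b + ā * b̄ + S      ≤⟨ +-monoˡ-≤ S (*+*≤* a≤m ā≤m b+b̄≤n₂) ⟩
      m * n₂ + S             ∎

  balanced-threshold : ∀ m → 1 ≤ m → m ≤ n₁ → m ≤ n₂ →
    ∃[ k ] ¬ (m ≤ linesMeeting value k × m ≤ linesMeeting column k)
           × m ≤ linesMeeting value (suc k) × m ≤ linesMeeting column (suc k)
  balanced-threshold m 1≤m m≤n₁ m≤n₂ =
    discrete-ivt (λ k → m ≤? linesMeeting value k ×-dec m ≤? linesMeeting column k) ¬balanced₀ balancedₙ
    where
    ¬balanced₀ : ¬ (m ≤ linesMeeting value 0 × m ≤ linesMeeting column 0)
    ¬balanced₀ (m≤rows₀ , _) =
      contradiction (≤-trans 1≤m (≤-trans m≤rows₀ (≤-reflexive (linesMeeting-zero value)))) λ ()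
    balancedₙ : m ≤ linesMeeting value (n₁ * n₂) × m ≤ linesMeeting column (n₁ * n₂)
    balancedₙ = ≤-trans m≤n₁ (≤-reflexive (sym (linesMeeting-all value j₀ (λ _ _ → toℕ<n _))))
              , ≤-trans m≤n₂ (≤-reflexive (sym (linesMeeting-all column i₀ (λ _ _ → toℕ<n _))))
      where
      i₀ : Fin n₁
      i₀ = fromℕ< (≤-trans 1≤m m≤n₁)
      j₀ : Fin n₂
      j₀ = fromℕ< (≤-trans 1≤m m≤n₂)

  spread-bound-even : ∀ m → 1 ≤ m → n₁ ≡ m * 2 → n₁ ≤ n₂ → n₁ * (n₂ + 1) ≤ 2 * (spread A + 1)
  spread-bound-even m 1≤m n₁≡ n₁≤n₂ with balanced-threshold m 1≤m m≤n₁ (≤-trans m≤n₁ n₁≤n₂)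
    where
    m≤n₁ : m ≤ n₁
    m≤n₁ = ≤-trans (m≤m*n m 2) (≤-reflexive (sym n₁≡))
  ... | k , unbalanced , m≤a′ , m≤b′ = begin
    n₁ * (n₂ + 1)       ≡⟨ cong (_* (n₂ + 1)) n₁≡ ⟩
    m * 2 * (n₂ + 1)    ≡⟨ solve (m ∷ n₂ ∷ []) ⟩
    2 * (m * (n₂ + 1))  ≤⟨ *-monoʳ-≤ 2 (+-cancelˡ-≤ (m * n₂) (m * (n₂ + 1)) S counted) ⟩
    2 * S               ∎
    where
    open ≤-Reasoning
    S = spread A + 1
    a = linesMeeting value k
    b = linesMeeting column k
    ā = linesAvoiding value (suc k)
    b̄ = linesAvoiding column (suc k)
    products≤ : a * b + ā * b̄ + m ≤ m * n₂
    products≤ = ab+āb̄+m≤mn unbalanced (linesMeeting-mono value k) (linesMeeting-mono column k) m≤a′ m≤b′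
                  (trans (linesMeeting+linesAvoiding value (suc k)) n₁≡) (linesMeeting+linesAvoiding column (suc k))
                  (≤-trans (≤-reflexive (sym n₁≡)) n₁≤n₂)
    counted : m * n₂ + m * (n₂ + 1) ≤ m * n₂ + S
    counted = begin
      m * n₂ + m * (n₂ + 1)  ≡⟨ solve (m ∷ n₂ ∷ []) ⟩
      m * 2 * n₂ + m         ≡⟨ cong (λ x → x * n₂ + m) n₁≡ ⟨
      n₁ * n₂ + m            ≤⟨ +-monoˡ-≤ m (cell-count-bound k) ⟩
      a * b + ā * b̄ + S + m  ≡⟨ xy∙z≈xz∙y (a * b + ā * b̄) S m ⟩
      a * b + ā * b̄ + m + S  ≤⟨ +-monoˡ-≤ S products≤ ⟩
      m * n₂ + S             ∎

mainTheorem2 : (n₁ n₂ : ℕ) → 1 ≤ n₁ → n₁ ≤ n₂ → (A : Arrangement n₁ n₂) →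
    (n₁ % 2 ≡ 1 → (n₁ + 1) * n₂ ≤ 2 * (spread A + 1)) ×
    (n₁ % 2 ≡ 0 → n₁ * (n₂ + 1) ≤ 2 * (spread A + 1))
mainTheorem2 n₁ n₂ 1≤n₁ n₁≤n₂ A = odd , even
  where
  m = n₁ / 2

  n₁≡ : ∀ {r} → n₁ % 2 ≡ r → n₁ ≡ r + m * 2
  n₁≡ n₁%2≡r = trans (m≡m%n+[m/n]*n n₁ 2) (cong (_+ m * 2) n₁%2≡r)

  odd : n₁ % 2 ≡ 1 → (n₁ + 1) * n₂ ≤ 2 * (spread A + 1)
  odd n₁%2≡1 = spread-bound-odd A (fromℕ< (≤-trans 1≤n₁ n₁≤n₂)) m (n₁≡ n₁%2≡1)

  even : n₁ % 2 ≡ 0 → n₁ * (n₂ + 1) ≤ 2 * (spread A + 1)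
  even n₁%2≡0 = spread-bound-even A m 1≤m (n₁≡ n₁%2≡0) n₁≤n₂
    where
    1≤m : 1 ≤ m
    1≤m = n≢0⇒n>0 (λ m≡0 → n>0⇒n≢0 1≤n₁ (trans (n₁≡ n₁%2≡0) (cong (_* 2) m≡0)))
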